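{- Let $\mathfrak n\in A$ be monic of positive degree, let $\{\lambda_j\}_{j=1}^{\deg\mathfrak n}$ be any $\mathbb F_q$-basis of $\Lambda_{\mathfrak n}$, and let $\{\lambda_i^*\}_{i=1}^{\deg\mathfrak n}\subseteq\Lambda^*_{\mathfrak n}$ satisfy $\langle\lambda_i^*,\lambda_j\rangle_{\mathrm{Poon}(\mathfrak n)}=-\delta_{ij}$ for all $i,j$. Then $$\lambda_i^*=(-1)^{\deg\mathfrak n+i}\Big(\frac{\Delta(\lambda_1,\dots,\lambda_{i-1},\lambda_{i+1},\dots,\lambda_{\deg\mathfrak n})}{\Delta(\lambda_1,\dots,\lambda_{\deg\mathfrak n})}\Big)^q\quad\text{for all }i.$$
   Context: Let $q$ be a power of a prime $p$, $A=\mathbb{F}_q[\theta]$, $k=\mathbb{F}_q(\theta)$, $\bar k$ an algebraic closure. Carlitz module $C_a(z)=\sum_ic_{a,i}z^{q^i}$ determined by $C_\theta(z)=\theta z+z^q$; adjoint Carlitz module $C^*_a(z)=\sum_ic_{a,i}^{q^{ -i}}z^{q^{ -i}}$. For monic $\mathfrak n$, $\Lambda_{\mathfrak n}$ and $\Lambda^*_{\mathfrak n}$ are the roots in $\bar k$ of $C_{\mathfrak n}$ and $C^*_{\mathfrak n}$ (both $\mathbb F_q$-vector spaces of dimension $\deg\mathfrak n$). Poonen pairing: for $a\in\Lambda^*_{\mathfrak n}$ write $a\tau^0C_{\mathfrak n}(\tau)=(\tau^0-\tau)h_a(\tau)$ in the twisted polynomial ring $\bar k\{\tau\}$ ($\tau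 c=c^q\tau$; elements identified with $\mathbb F_q$-linear polynomials), and set $\langle a,b\rangle_{\mathrm{Poon}(\mathfrak n)}=h_a(b)\in\mathbb F_q$ for $b\in\Lambda_{\mathfrak n}$. Moore determinant: $\Delta(x_1,\dots,x_n)=\det_{1\le i,j\le n}(x_j^{q^{i-1}})$. -}

module Defs where

open import Level using (Level; _⊔_) renaming (suc to lsuc)
open import Algebra.Bundles using (CommutativeRing)
open import Data.Nat using (ℕ; zero; suc) renaming (_^_ to _^ℕ_)
open import Data.Fin as Fin using (Fin; zero; suc; toℕ; punchIn)
open import Data.List using (List; []; _∷_; _++_; map; length; tabulate)
open import Data.List.Relation.Unary.All using (All)
open import Data.List.Relation.Unary.Any using (Any)
open import Data.Product using (Σ; ∃; _×_; _,_)
open import Relation.Nullary using (¬_; yes; no)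

record Field (c ℓ : Level) : Set (lsuc (c ⊔ ℓ)) where
  field
    baseRing : CommutativeRing c ℓ
  open CommutativeRing baseRing public
  field
    nontrivial : ¬ (1# ≈ 0#)
    inv        : (x : Carrier) → ¬ (x ≈ 0#) → Carrier
    inv-r      : ∀ x (nz : ¬ (x ≈ 0#)) → x * inv x nz ≈ 1#

-- Everything below lives in a field K, with q a natural number
-- (in the statement: q = p^e, char K = p).

module Over {c ℓ : Level} (F : Field c ℓ) (q : ℕ) where
  open Field F using (Carrier; _≈_; _+_; _*_; -_; 0#; 1#)

  _^_ : Carrier → ℕ → Carrier
  x ^ zero  = 1#
  x ^ suc n = x * (x ^ n)

  fromℕ : ℕ → Carrier
  fromℕ zero    = 0#
  fromℕ (suc n) = 1# + fromℕ n

  sign : ℕ → Carrier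
  sign zero    = 1#
  sign (suc k) = - sign k

  sumFin : (n : ℕ) → (Fin n → Carrier) → Carrier
  sumFin zero    f = 0#
  sumFin (suc n) f = f zero + sumFin n (λ i → f (suc i))

  δ : ∀ {n} → Fin n → Fin n → Carrier
  δ i j with i Fin.≟ j
  ... | yes _ = 1#
  ... | no  _ = 0#

  InFq : Carrier → Set ℓ
  InFq x = (x ^ q) ≈ x

  eval : List Carrier → Carrier → Carrier
  eval []       x = 0#
  eval (a ∷ as) x = a + x * eval as x

  -- Twisted polynomials  K{τ}, τ c = c^q τ, as coefficient lists
  -- [c₀, c₁, …] ↦ Σ cᵢ τ^i.  (c ∷ f) stands for c + f·τ.

  TPoly : Set c
  TPoly = List Carrier

  coeff : TPoly → ℕ → Carrier
  coeff []       n       = 0#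
  coeff (a ∷ f)  zero    = a
  coeff (a ∷ f)  (suc n) = coeff f n

  -- equality of twisted polynomials (coefficientwise, trailing zeros ignored)
  _≈τ_ : TPoly → TPoly → Set ℓ
  f ≈τ g = ∀ n → coeff f n ≈ coeff g n

  _+τ_ : TPoly → TPoly → TPoly
  []      +τ g       = g
  (a ∷ f) +τ []      = a ∷ f
  (a ∷ f) +τ (b ∷ g) = (a + b) ∷ (f +τ g)

  scale : Carrier → TPoly → TPoly
  scale c f = map (c *_) f

  -- left multiplication by τ:  τ · Σ gₖ τ^k = Σ gₖ^q τ^(k+1)
  τ·_ : TPoly → TPoly
  τ· g = 0# ∷ map (_^ q) g

  -- product in K{τ}:  (a + f τ) g = a g + f (τ g)
  _*τ_ : TPoly → TPoly → TPoly
  []      *τ g = []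
  (a ∷ f) *τ g = scale a g +τ (f *τ (τ· g))

  -- the F_q-linear polynomial attached to f:  (Σ cᵢ τ^i)(x) = Σ cᵢ x^(q^i)
  apply : TPoly → Carrier → Carrier
  apply []      x = 0#
  apply (a ∷ f) x = a * x + apply f (x ^ q)

  -- Carlitz module, with θ ↦ t ∈ K.
  -- Elements of A = F_q[θ] are coefficient lists (constant term first)
  -- with entries in F_q ⊆ K.

  module Carlitz (t : Carrier) where

    Cθ : TPoly
    Cθ = t ∷ 1# ∷ []

    C : List Carrier → TPoly
    C []       = []
    C (a ∷ as) = (a ∷ []) +τ (Cθ *τ C as)

    InΛ : List Carrier → Carrier → Set ℓ
    InΛ n x = apply (C n) x ≈ 0#

    -- Λ*_n : roots of C*_n(z) = Σ c_{n,i}^(q^-i) z^(q^-i) = Σ (c_{n,i} z)^(q^-i).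
    -- rᵢ is the (unique, Frobenius being injective) q^i-th root of c_{n,i} a.
    InΛ* : List Carrier → Carrier → Set (c ⊔ ℓ)
    InΛ* n a = Σ (Fin (length (C n)) → Carrier) λ r →
                 (∀ i → (r i ^ (q ^ℕ toℕ i)) ≈ coeff (C n) (toℕ i) * a)
               × sumFin (length (C n)) r ≈ 0#

    PoonenPairing : List Carrier → Carrier → Carrier → Carrier → Set (c ⊔ ℓ)
    PoonenPairing n a b v = Σ TPoly λ h →
        ((a ∷ []) *τ C n) ≈τ ((1# ∷ (- 1#) ∷ []) *τ h)
      × apply h b ≈ v

  det : (n : ℕ) → (Fin n → Fin n → Carrier) → Carrier
  det zero    M = 1#
  det (suc n) M = sumFin (suc n) λ j →
    sign (toℕ j) * (M zero j * det n (λ r k → M (suc r) (punchIn j k)))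

  Moore : (n : ℕ) → (Fin n → Carrier) → Carrier
  Moore n x = det n (λ i j → x j ^ (q ^ℕ toℕ i))

record IsAlgClosureOfFqθ {c ℓ : Level} (F : Field c ℓ) (p q : ℕ) (t : Field.Carrier F)
       : Set (c ⊔ ℓ) where
  open Field F using (Carrier; _≈_; 0#; 1#)
  open Over F q
  field
    char-p : fromℕ p ≈ 0#
    transcendental : ∀ (P : List Carrier) → All InFq P → eval P t ≈ 0#
                     → All (_≈ 0#) P
    alg-closed : ∀ (a₀ : Carrier) (as : List Carrier) →
                 ∃ λ x → eval (a₀ ∷ as ++ (1# ∷ [])) x ≈ 0#
    algebraic : ∀ (x : Carrier) → ∃ λ (P : List (List Carrier)) →
                  All (All InFq) P
                × Any (λ a → ¬ (eval a t ≈ 0#)) P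
                × eval (map (λ a → eval a t) P) x ≈ 0#

{-# OPTIONS --safe #-}
module Submission where

-- For a ∈ Λ*_𝔫 write a C_𝔫 = (1 - τ) h_a.  Comparing coefficients, h_{a,0} = a c₀ and
-- h_{a,k+1} = h_{a,k}^q + a c_{k+1}, so in characteristic p the coefficient h_{a,d} (d = deg 𝔫 = m + 1)
-- is the q^d-th power of Σᵢ (cᵢ a)^(q^-i), which vanishes because a is a root of C*_𝔫.  As c_d = 1,
-- h_a has degree ≤ m and a = (- h_{a,m})^q.  The pairing condition says that (- h_{λ*_i,k})_{i,k} is a
-- left inverse of the Moore matrix (λ_j^(q^k))_{k,j}; by multiplicativity of the determinant the Moore
-- determinant is nonzero, and the adjugate formula gives - h_{λ*_i,m} = ± Δ(λ without λ_i) / Δ(λ).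
-- Raising to the q-th power gives the claim.  The hypotheses that the λ_j form a basis and that 𝔫 has
-- coefficients in F_q are not needed.

open import Defs
open import Level using (_⊔_)
open import Data.Nat as ℕ using (ℕ; suc; _≤_; _!) renaming (_^_ to _^ℕ_; _+_ to _+ℕ_)
open import Data.Fin as Fin using (Fin; zero; suc; toℕ; punchIn; pinch; punchOut)
open import Data.Fin.Properties using (suc-injective; toℕ-fromℕ; toℕ-inject₁; inject₁ℕ<)
open import Data.List using (List; []; _∷_; _++_; map; length; tabulate)
open import Data.Product using (Σ; ∃; _×_; _,_; proj₁; proj₂)
open import Data.Nat.Divisibility using (_∣_; divides; ∣1⇒≡1; ∣⇒≤; m∣m*n)
open import Data.Nat.Primality using (Prime; prime⇒nonTrivial; prime⇒nonZero; euclidsLemma)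
open import Data.Nat.Combinatorics using (_C_; nCk≡n!/k![n-k]!; k![n∸k]!∣n!; nCk≡nC[n∸k]; nCn≡1)
open import Data.Nat.DivMod using (m/n*n≡m)
import Data.Nat.Properties as ℕP
open import Data.Sum using (inj₁; inj₂)
open import Data.Empty using (⊥-elim)
open import Function using (id; _∘_; const)
open import Relation.Nullary using (¬_; Dec; yes; no)
open import Relation.Binary.PropositionalEquality as ≡ using (_≡_; _≢_)
import Algebra.Properties.CommutativeSemigroup

punchIn-punchIn-pinch : ∀ {n} (k : Fin (suc n)) (j : Fin n) → punchIn (punchIn k j) (pinch j k) ≡ k
punchIn-punchIn-pinch zero          zero    = ≡.refl
punchIn-punchIn-pinch zero          (suc j) = ≡.refl
punchIn-punchIn-pinch {suc n} (suc k) zero    = ≡.refl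
punchIn-punchIn-pinch {suc n} (suc k) (suc j) = ≡.cong suc (punchIn-punchIn-pinch k j)

punchIn-punchIn : ∀ {n} (k : Fin (suc (suc n))) (j : Fin (suc n)) (y : Fin n) →
                  punchIn k (punchIn j y) ≡ punchIn (punchIn k j) (punchIn (pinch j k) y)
punchIn-punchIn zero          zero    y       = ≡.refl
punchIn-punchIn zero          (suc j) y       = ≡.refl
punchIn-punchIn (suc k)       zero    y       = ≡.refl
punchIn-punchIn {suc n} (suc k) (suc j) zero    = ≡.refl
punchIn-punchIn {suc n} (suc k) (suc j) (suc y) = ≡.cong suc (punchIn-punchIn k j y)

toℕ-punchIn-fromℕ : ∀ {n} (x : Fin n) → toℕ (punchIn (Fin.fromℕ n) x) ≡ toℕ x
toℕ-punchIn-fromℕ {suc n} zero    = ≡.refl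
toℕ-punchIn-fromℕ {suc n} (suc x) = ≡.cong suc (toℕ-punchIn-fromℕ x)

prime∤! : ∀ {p} → Prime p → ∀ j → j ℕ.< p → ¬ p ∣ j !
prime∤! pr ℕ.zero  _   p∣1 = ℕ.nonTrivial⇒≢1 {{prime⇒nonTrivial pr}} (∣1⇒≡1 p∣1)
prime∤! pr (suc j) j<p p∣j! with euclidsLemma (suc j) (j !) pr p∣j!
... | inj₁ p∣1+j = ℕP.<⇒≱ j<p (∣⇒≤ p∣1+j)
... | inj₂ p∣j!′ = prime∤! pr j (ℕP.<-trans (ℕP.n<1+n j) j<p) p∣j!′

prime∣C : ∀ {p k} → Prime p → 0 ℕ.< k → k ℕ.< p → p ∣ p C k
prime∣C {p@(suc p-1)} {k} pr 0<k k<p with euclidsLemma (p C k) (k ! ℕ.* (p ℕ.∸ k) !) pr p∣product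
  where
    k≤p : k ≤ p
    k≤p = ℕP.<⇒≤ k<p
    p∣product : p ∣ (p C k) ℕ.* (k ! ℕ.* (p ℕ.∸ k) !)
    p∣product = ≡.subst (p ∣_)
      (≡.sym (≡.trans (≡.cong (ℕ._* (k ! ℕ.* (p ℕ.∸ k) !)) (nCk≡n!/k![n-k]! k≤p))
                      (m/n*n≡m {{ℕP._!*_!≢0 k (p ℕ.∸ k)}} (k![n∸k]!∣n! k≤p))))
      (m∣m*n (p-1 !))
... | inj₁ p∣C = p∣C
... | inj₂ p∣k![p-k]! with euclidsLemma (k !) ((p ℕ.∸ k) !) pr p∣k![p-k]!
...   | inj₁ p∣k! = ⊥-elim (prime∤! pr k k<p p∣k!)
...   | inj₂ p∣[p-k]! = ⊥-elim (prime∤! pr (p ℕ.∸ k) (ℕP.∸-monoʳ-< 0<k (ℕP.<⇒≤ k<p)) p∣[p-k]!)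

module FieldFacts {c ℓ} (F : Field c ℓ) where
  open Field F
  open import Algebra.Solver.CommutativeMonoid *-commutativeMonoid using (solve; _⊜_; _⊕_)

  a[b[c[d[ef]]]]≈[d[ae]][c[bf]] : ∀ a b c d e f → a * (b * (c * (d * (e * f)))) ≈ (d * (a * e)) * (c * (b * f))
  a[b[c[d[ef]]]]≈[d[ae]][c[bf]] =
    solve 6 (λ a b c d e f → a ⊕ (b ⊕ (c ⊕ (d ⊕ (e ⊕ f)))) ⊜ (d ⊕ (a ⊕ e)) ⊕ (c ⊕ (b ⊕ f))) refl

  a[b[c[d[ef]]]]≈[b[cd]][a[ef]] : ∀ a b c d e f → a * (b * (c * (d * (e * f)))) ≈ (b * (c * d)) * (a * (e * f))
  a[b[c[d[ef]]]]≈[b[cd]][a[ef]] =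
    solve 6 (λ a b c d e f → a ⊕ (b ⊕ (c ⊕ (d ⊕ (e ⊕ f)))) ⊜ (b ⊕ (c ⊕ d)) ⊕ (a ⊕ (e ⊕ f))) refl

  a[b[c[de]]]≈[ac][b[de]] : ∀ a b c d e → a * (b * (c * (d * e))) ≈ (a * c) * (b * (d * e))
  a[b[c[de]]]≈[ac][b[de]] =
    solve 5 (λ a b c d e → a ⊕ (b ⊕ (c ⊕ (d ⊕ e))) ⊜ (a ⊕ c) ⊕ (b ⊕ (d ⊕ e))) refl

  [ab][c[a[de]]]≈[aa][d[c[be]]] : ∀ a b c d e → (a * b) * (c * (a * (d * e))) ≈ (a * a) * (d * (c * (b * e)))
  [ab][c[a[de]]]≈[aa][d[c[be]]] =
    solve 5 (λ a b c d e → (a ⊕ b) ⊕ (c ⊕ (a ⊕ (d ⊕ e))) ⊜ (a ⊕ a) ⊕ (d ⊕ (c ⊕ (b ⊕ e)))) refl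

  open import Algebra.Properties.Ring ring public
    using (-‿involutive; -0#≈0#; -‿distribˡ-*; -‿distribʳ-*; -‿+-comm; +-inverseʳ-unique)

  module + = Algebra.Properties.CommutativeSemigroup +-commutativeSemigroup
  module * = Algebra.Properties.CommutativeSemigroup *-commutativeSemigroup

  ≡⇒≈ : ∀ {x y} → x ≡ y → x ≈ y
  ≡⇒≈ ≡.refl = refl

  x*[y*z]≈0 : ∀ x y {z} → z ≈ 0# → x * (y * z) ≈ 0#
  x*[y*z]≈0 x y z≈0 = trans (*-congˡ (trans (*-congˡ z≈0) (zeroʳ y))) (zeroʳ x)

  x*y≈z⇒x≈z*y⁻¹ : ∀ {x y z} (y≉0 : ¬ y ≈ 0#) → x * y ≈ z → x ≈ z * inv y y≉0
  x*y≈z⇒x≈z*y⁻¹ {x} {y} {z} y≉0 xy≈z = begin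
    x                    ≈⟨ sym (*-identityʳ x) ⟩
    x * 1#               ≈⟨ *-congˡ (sym (inv-r y y≉0)) ⟩
    x * (y * inv y y≉0)  ≈⟨ sym (*-assoc x y _) ⟩
    (x * y) * inv y y≉0  ≈⟨ *-congʳ xy≈z ⟩
    z * inv y y≉0        ∎
    where open import Relation.Binary.Reasoning.Setoid setoid

  -‿*-‿ : ∀ x y → - x * - y ≈ x * y
  -‿*-‿ x y = trans (sym (-‿distribˡ-* x (- y))) (trans (-‿cong (sym (-‿distribʳ-* x y))) (-‿involutive _))

module SignsAndDeltas {c ℓ} (F : Field c ℓ) (q : ℕ) where
  open Field F hiding (zero)
  open Over F q
  open FieldFacts F

  sign-+ : ∀ a b → sign (a +ℕ b) ≈ sign a * sign b
  sign-+ ℕ.zero    b = sym (*-identityˡ _)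
  sign-+ (suc a) b = trans (-‿cong (sign-+ a b)) (-‿distribˡ-* _ _)

  sign-suc-suc : ∀ n → sign (suc (suc n)) ≈ sign n
  sign-suc-suc n = -‿involutive (sign n)

  sign-suc+suc : ∀ m n → sign (suc m +ℕ suc n) ≈ sign (m +ℕ n)
  sign-suc+suc m n = trans (≡⇒≈ (≡.cong (λ k → sign (suc k)) (ℕP.+-suc m n))) (sign-suc-suc (m +ℕ n))

  sign*sign : ∀ a → sign a * sign a ≈ 1#
  sign*sign ℕ.zero    = *-identityˡ 1#
  sign*sign (suc a) = trans (-‿*-‿ _ _) (sign*sign a)

  sign-punchIn-pinch : ∀ {n} (k : Fin (suc n)) (j : Fin n) →
    sign (toℕ (punchIn k j)) * sign (toℕ (pinch j k)) ≈ - (sign (toℕ k) * sign (toℕ j))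
  sign-punchIn-pinch {suc n} zero j =
    trans (*-identityʳ _) (-‿cong (sym (*-identityˡ _)))
  sign-punchIn-pinch {suc n} (suc k) zero =
    trans (*-identityˡ _) (trans (sym (-‿involutive _)) (-‿cong (sym (*-identityʳ _))))
  sign-punchIn-pinch {suc n} (suc k) (suc j) =
    trans (-‿*-‿ _ _) (trans (sign-punchIn-pinch k j) (-‿cong (sym (-‿*-‿ _ _))))

  δ-≡ : ∀ {n} {i j : Fin n} → i ≡ j → δ i j ≈ 1#
  δ-≡ {i = i} {j} i≡j with i Fin.≟ j
  ... | yes _   = refl
  ... | no i≢j  = ⊥-elim (i≢j i≡j)

  δ-refl : ∀ {n} (i : Fin n) → δ i i ≈ 1#
  δ-refl i = δ-≡ {i = i} ≡.refl

  δ-≢ : ∀ {n} {i j : Fin n} → i ≢ j → δ i j ≈ 0#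
  δ-≢ {i = i} {j} i≢j with i Fin.≟ j
  ... | yes i≡j = ⊥-elim (i≢j i≡j)
  ... | no _    = refl

  δ-suc : ∀ {n} (i j : Fin n) → δ (suc i) (suc j) ≈ δ i j
  δ-suc i j = by-cases (i Fin.≟ j)
    where
      by-cases : Dec (i ≡ j) → δ (suc i) (suc j) ≈ δ i j
      by-cases (yes i≡j) = trans (δ-≡ (≡.cong suc i≡j)) (sym (δ-≡ i≡j))
      by-cases (no i≢j)  = trans (δ-≢ (i≢j ∘ suc-injective)) (sym (δ-≢ i≢j))

  δ-sym : ∀ {n} (i j : Fin n) → δ i j ≈ δ j i
  δ-sym i j with i Fin.≟ j | j Fin.≟ i
  ... | yes _   | yes _   = refl
  ... | no _    | no _    = refl
  ... | yes i≡j | no j≢i  = ⊥-elim (j≢i (≡.sym i≡j))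
  ... | no i≢j  | yes j≡i = ⊥-elim (i≢j (≡.sym j≡i))

module FiniteSums {c ℓ} (F : Field c ℓ) (q : ℕ) where
  open Field F hiding (zero)
  open Over F q
  open FieldFacts F
  open SignsAndDeltas F q

  sumFin-cong : ∀ n {f g : Fin n → Carrier} → (∀ i → f i ≈ g i) → sumFin n f ≈ sumFin n g
  sumFin-cong ℕ.zero    f≈g = refl
  sumFin-cong (suc n) f≈g = +-cong (f≈g zero) (sumFin-cong n (λ i → f≈g (suc i)))

  sumFin-zero : ∀ n {f : Fin n → Carrier} → (∀ i → f i ≈ 0#) → sumFin n f ≈ 0#
  sumFin-zero ℕ.zero    f≈0 = refl
  sumFin-zero (suc n) f≈0 = trans (+-cong (f≈0 zero) (sumFin-zero n (λ i → f≈0 (suc i)))) (+-identityˡ 0#)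

  sumFin-distrib-+ : ∀ n (f g : Fin n → Carrier) →
                     sumFin n (λ i → f i + g i) ≈ sumFin n f + sumFin n g
  sumFin-distrib-+ ℕ.zero    f g = sym (+-identityˡ 0#)
  sumFin-distrib-+ (suc n) f g =
    trans (+-congˡ (sumFin-distrib-+ n (λ i → f (suc i)) (λ i → g (suc i)))) (+.interchange _ _ _ _)

  *-distribˡ-sumFin : ∀ n x (f : Fin n → Carrier) → x * sumFin n f ≈ sumFin n (λ i → x * f i)
  *-distribˡ-sumFin ℕ.zero  x f = zeroʳ x
  *-distribˡ-sumFin (suc n) x f = trans (distribˡ x _ _) (+-congˡ (*-distribˡ-sumFin n x (λ i → f (suc i))))

  *-distribʳ-sumFin : ∀ n x (f : Fin n → Carrier) → sumFin n f * x ≈ sumFin n (λ i → f i * x)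
  *-distribʳ-sumFin n x f =
    trans (*-comm _ x) (trans (*-distribˡ-sumFin n x f) (sumFin-cong n (λ i → *-comm x (f i))))

  -‿sumFin : ∀ n (f : Fin n → Carrier) → - sumFin n f ≈ sumFin n (λ i → - f i)
  -‿sumFin ℕ.zero  f = -0#≈0#
  -‿sumFin (suc n) f = trans (sym (-‿+-comm _ _)) (+-congˡ (-‿sumFin n (λ i → f (suc i))))

  *-distribˡ-sumFin-twice : ∀ {n} x y (f : Fin n → Carrier) → x * (y * sumFin n f) ≈ sumFin n (λ i → x * (y * f i))
  *-distribˡ-sumFin-twice {n} x y f = trans (*-congˡ (*-distribˡ-sumFin n y f)) (*-distribˡ-sumFin n x (λ i → y * f i))

  sumFin-comm : ∀ n m (f : Fin n → Fin m → Carrier) →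
                sumFin n (λ i → sumFin m (f i)) ≈ sumFin m (λ j → sumFin n (λ i → f i j))
  sumFin-comm ℕ.zero  m f = sym (sumFin-zero m (λ _ → refl))
  sumFin-comm (suc n) m f =
    trans (+-congˡ (sumFin-comm n m (λ i → f (suc i))))
          (sym (sumFin-distrib-+ m (f zero) (λ j → sumFin n (λ i → f (suc i) j))))

  sumFin-single : ∀ n (f : Fin n → Carrier) k → (∀ i → i ≢ k → f i ≈ 0#) → sumFin n f ≈ f k
  sumFin-single (suc n) f zero    f≈0 =
    trans (+-congˡ (sumFin-zero n (λ i → f≈0 (suc i) λ ()))) (+-identityʳ _)
  sumFin-single (suc n) f (suc k) f≈0 =
    trans (+-congʳ (f≈0 zero λ ()))
          (trans (+-identityˡ _) (sumFin-single n (λ i → f (suc i)) k (λ i i≢k → f≈0 (suc i) (i≢k ∘ suc-injective))))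

  sumFin-δ : ∀ n k (f : Fin n → Carrier) → sumFin n (λ i → δ k i * f i) ≈ f k
  sumFin-δ n k f =
    trans (sumFin-single n _ k (λ i i≢k → trans (*-congʳ (δ-≢ (i≢k ∘ ≡.sym))) (zeroˡ (f i))))
          (trans (*-congʳ (δ-refl k)) (*-identityˡ (f k)))

  sumFin-init-last : ∀ n (f : Fin (suc n) → Carrier) →
                     sumFin (suc n) f ≈ sumFin n (λ i → f (Fin.inject₁ i)) + f (Fin.fromℕ n)
  sumFin-init-last ℕ.zero  f = trans (+-identityʳ _) (sym (+-identityˡ _))
  sumFin-init-last (suc n) f = trans (+-congˡ (sumFin-init-last n (λ i → f (suc i)))) (sym (+-assoc _ _ _))

  -- The pairs (k , punchIn k j) enumerate the ordered pairs of distinct indices,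
  -- and (k , j) ↦ (punchIn k j , pinch j k) is the involution swapping the two entries.
  sumFin-pairs-swap : ∀ n (g h : Fin (suc n) → Fin n → Carrier) →
    (∀ k j → g k j ≈ h (punchIn k j) (pinch j k)) →
    sumFin (suc n) (λ k → sumFin n (g k)) ≈ sumFin (suc n) (λ j → sumFin n (h j))
  sumFin-pairs-swap ℕ.zero  g h g≈h = refl
  sumFin-pairs-swap (suc n) g h g≈h =
    trans (+-congˡ (sumFin-distrib-+ (suc n) (λ k → g (suc k) zero) (λ k → sumFin n (λ j → g (suc k) (suc j)))))
     (trans (+-cong (sumFin-cong (suc n) (g≈h zero))
                    (+-cong (sumFin-cong (suc n) (λ k → g≈h (suc k) zero))
                            (sumFin-pairs-swap n (λ k j → g (suc k) (suc j)) (λ j k → h (suc j) (suc k))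
                                               (λ k j → g≈h (suc k) (suc j)))))
      (trans (+.x∙yz≈y∙xz _ _ _)
             (+-congˡ (sym (sumFin-distrib-+ (suc n) (λ j → h (suc j) zero) (λ j → sumFin n (λ k → h (suc j) (suc k))))))))

  sumFin-pairs-cancel : ∀ n (g : Fin (suc n) → Fin n → Carrier) →
    (∀ k j → g k j + g (punchIn k j) (pinch j k) ≈ 0#) →
    sumFin (suc n) (λ k → sumFin n (g k)) ≈ 0#
  sumFin-pairs-cancel ℕ.zero  g cancel = +-identityˡ 0#
  sumFin-pairs-cancel (suc n) g cancel =
    trans (+-congˡ (sumFin-distrib-+ (suc n) (λ k → g (suc k) zero) (λ k → sumFin n (λ j → g (suc k) (suc j)))))
     (trans (sym (+-assoc _ _ _))
      (trans (+-cong (trans (sym (sumFin-distrib-+ (suc n) (g zero) (λ k → g (suc k) zero)))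
                            (sumFin-zero (suc n) (cancel zero)))
                     (sumFin-pairs-cancel n (λ k j → g (suc k) (suc j)) (λ k j → cancel (suc k) (suc j))))
             (+-identityˡ 0#)))

module Determinants {c ℓ} (F : Field c ℓ) (q : ℕ) where
  open Field F hiding (zero)
  open Over F q
  open FieldFacts F
  open SignsAndDeltas F q
  open FiniteSums F q
  open import Data.Vec.Functional using (updateAt)
  open import Data.Vec.Functional.Properties using (updateAt-updates; updateAt-minimal)
  open import Data.Fin.Properties using (punchInᵢ≢i; punchIn-punchOut; any?; toℕ-fromℕ<; toℕ-injective; toℕ<n)
  open import Relation.Binary.Reasoning.Setoid setoid

  Matrix : ℕ → Set c
  Matrix n = Fin n → Fin n → Carrier

  minor : ∀ {n} → Matrix (suc n) → Fin (suc n) → Fin (suc n) → Matrix n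
  minor M r j x y = M (punchIn r x) (punchIn j y)

  cofactor : ∀ {n} → Matrix (suc n) → Fin (suc n) → Fin (suc n) → Carrier
  cofactor {n} M r j = sign (toℕ r) * (sign (toℕ j) * det n (minor M r j))

  replaceRow : ∀ {n} → Matrix n → Fin n → (Fin n → Carrier) → Matrix n
  replaceRow M r v = updateAt M r (const v)

  replaceRow-≡ : ∀ {n} (M : Matrix n) r v j → replaceRow M r v r j ≈ v j
  replaceRow-≡ M r v j = ≡⇒≈ (≡.cong-app (updateAt-updates r M) j)

  replaceRow-≢ : ∀ {n} (M : Matrix n) {r i} v j → i ≢ r → replaceRow M r v i j ≈ M i j
  replaceRow-≢ M {r} {i} v j i≢r = ≡⇒≈ (≡.cong-app (updateAt-minimal i r M i≢r) j)

  det-cong : ∀ n {A B : Matrix n} → (∀ i j → A i j ≈ B i j) → det n A ≈ det n B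
  det-cong ℕ.zero  A≈B = refl
  det-cong (suc n) {A} {B} A≈B = sumFin-cong (suc n) terms≈
    where
      terms≈ : ∀ j → sign (toℕ j) * (A zero j * det n (minor A zero j)) ≈ sign (toℕ j) * (B zero j * det n (minor B zero j))
      terms≈ j = *-congˡ (*-cong (A≈B zero j) (det-cong n (λ r k → A≈B (suc r) (punchIn j k))))

  det-expand : ∀ n (M : Matrix (suc n)) r → det (suc n) M ≈ sumFin (suc n) (λ j → M r j * cofactor M r j)
  det-expand n M zero =
    sumFin-cong (suc n) (λ j → trans (*.x∙yz≈y∙xz (sign (toℕ j)) (M zero j) (det n (minor M zero j)))
                                     (*-congˡ (sym (*-identityˡ (sign (toℕ j) * det n (minor M zero j))))))
  -- Expanding along row 0 and then along row r of each minor, or along row r + 1 and then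
  -- along row 0 of each minor, sums the same products over the pairs of distinct columns.
  det-expand (suc n) M (suc r) = begin
    det (suc (suc n)) M
      ≈⟨ sumFin-cong (suc (suc n)) (λ k → *-congˡ {sign (toℕ k)} (*-congˡ {M zero k} (det-expand n (below k) r))) ⟩
    sumFin (suc (suc n)) (λ k → sign (toℕ k) * (M zero k * sumFin (suc n) (T k)))
      ≈⟨ sumFin-cong (suc (suc n)) (λ k → *-distribˡ-sumFin-twice (sign (toℕ k)) (M zero k) (T k)) ⟩
    sumFin (suc (suc n)) (λ k → sumFin (suc n) (g k))
      ≈⟨ sumFin-pairs-swap (suc n) g h g≈h ⟩
    sumFin (suc (suc n)) (λ j → sumFin (suc n) (h j))
      ≈⟨ sumFin-cong (suc (suc n)) (λ j → sym (trans
           (*-congˡ (*-distribˡ-sumFin-twice (sign (toℕ (suc r))) (sign (toℕ j)) (D j)))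
           (*-distribˡ-sumFin (suc n) (M (suc r) j) (λ k → sign (toℕ (suc r)) * (sign (toℕ j) * D j k))))) ⟩
    sumFin (suc (suc n)) (λ j → M (suc r) j * cofactor M (suc r) j) ∎
    where
      below : Fin (suc (suc n)) → Matrix (suc n)
      below k a b = M (suc a) (punchIn k b)
      T : Fin (suc (suc n)) → Fin (suc n) → Carrier
      T k j = below k r j * cofactor (below k) r j
      g : Fin (suc (suc n)) → Fin (suc n) → Carrier
      g k j = sign (toℕ k) * (M zero k * T k j)
      D : Fin (suc (suc n)) → Fin (suc n) → Carrier
      D j k = sign (toℕ k) * (M zero (punchIn j k) * det n (λ a b → M (suc (punchIn r a)) (punchIn j (punchIn k b))))
      h : Fin (suc (suc n)) → Fin (suc n) → Carrier
      h j k = M (suc r) j * (sign (toℕ (suc r)) * (sign (toℕ j) * D j k))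
      g≈h : ∀ k j → g k j ≈ h (punchIn k j) (pinch j k)
      g≈h k j = trans (a[b[c[d[ef]]]]≈[d[ae]][c[bf]] _ _ _ _ _ _)
        (trans (*-cong signs (*-congˡ (*-cong (≡⇒≈ (≡.cong (M zero) (≡.sym (punchIn-punchIn-pinch k j))))
                                              (det-cong n (λ a b → ≡⇒≈ (≡.cong (M (suc (punchIn r a))) (punchIn-punchIn k j b)))))))
               (sym (a[b[c[d[ef]]]]≈[b[cd]][a[ef]] _ _ _ _ _ _)))
        where
          signs : sign (toℕ r) * (sign (toℕ k) * sign (toℕ j))
                ≈ sign (toℕ (suc r)) * (sign (toℕ (punchIn k j)) * sign (toℕ (pinch j k)))
          signs = trans (sym (-‿*-‿ _ _)) (*-congˡ (sym (sign-punchIn-pinch k j)))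

  cofactor-replaceRow : ∀ {n} (M : Matrix (suc n)) r v j → cofactor (replaceRow M r v) r j ≈ cofactor M r j
  cofactor-replaceRow {n} M r v j =
    *-congˡ (*-congˡ (det-cong n (λ x y → replaceRow-≢ M v (punchIn j y) (punchInᵢ≢i r x))))

  det-replaceRow : ∀ n (M : Matrix (suc n)) r v →
                   det (suc n) (replaceRow M r v) ≈ sumFin (suc n) (λ j → v j * cofactor M r j)
  det-replaceRow n M r v = trans (det-expand n (replaceRow M r v) r)
    (sumFin-cong (suc n) (λ j → *-cong (replaceRow-≡ M r v j) (cofactor-replaceRow M r v j)))

  mutual
    det-equalRows : ∀ n (M : Matrix n) {r s} → r ≢ s → (∀ j → M r j ≈ M s j) → det n M ≈ 0#
    det-equalRows (suc n) M {zero}  {zero}  r≢s _   = ⊥-elim (r≢s ≡.refl)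
    det-equalRows (suc n) M {zero}  {suc s} _   r≈s = det-equalRows₀ n M s r≈s
    det-equalRows (suc n) M {suc r} {zero}  _   r≈s = det-equalRows₀ n M r (λ j → sym (r≈s j))
    det-equalRows (suc n) M {suc r} {suc s} r≢s r≈s = sumFin-zero (suc n) (λ k →
      x*[y*z]≈0 (sign (toℕ k)) (M zero k)
        (det-equalRows n (minor M zero k) (r≢s ∘ ≡.cong suc) (λ j → r≈s (punchIn k j))))

    det-equalRows₀ : ∀ n (M : Matrix (suc n)) s → (∀ j → M zero j ≈ M (suc s) j) → det (suc n) M ≈ 0#
    det-equalRows₀ (suc n) M zero M₀≈M₁ = begin
      det (suc (suc n)) M
        ≈⟨ sumFin-cong (suc (suc n)) (λ k →
             *-distribˡ-sumFin-twice (sign (toℕ k)) (M zero k) (λ j → sign (toℕ j) * (M (suc zero) (punchIn k j) * D k j))) ⟩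
      sumFin (suc (suc n)) (λ k → sumFin (suc n) (g k))
        ≈⟨ sumFin-pairs-cancel (suc n) g (λ k j → trans (+-congˡ (swapped k j)) (-‿inverseʳ (g k j))) ⟩
      0# ∎
      where
        D : Fin (suc (suc n)) → Fin (suc n) → Carrier
        D k j = det n (λ a b → M (suc (suc a)) (punchIn k (punchIn j b)))
        g : Fin (suc (suc n)) → Fin (suc n) → Carrier
        g k j = sign (toℕ k) * (M zero k * (sign (toℕ j) * (M (suc zero) (punchIn k j) * D k j)))
        swapped : ∀ k j → g (punchIn k j) (pinch j k) ≈ - g k j
        swapped k j = begin
          g (punchIn k j) (pinch j k)
            ≈⟨ a[b[c[de]]]≈[ac][b[de]] _ _ _ _ _ ⟩
          (sign (toℕ (punchIn k j)) * sign (toℕ (pinch j k))) *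
            (M zero (punchIn k j) * (M (suc zero) (punchIn (punchIn k j) (pinch j k)) * D (punchIn k j) (pinch j k)))
            ≈⟨ *-cong (sign-punchIn-pinch k j) (trans (*-cong (M₀≈M₁ (punchIn k j))
                 (*-cong (trans (≡⇒≈ (≡.cong (M (suc zero)) (punchIn-punchIn-pinch k j))) (sym (M₀≈M₁ k)))
                         (det-cong n (λ a b → ≡⇒≈ (≡.cong (M (suc (suc a))) (≡.sym (punchIn-punchIn k j b)))))))
                 (*.x∙yz≈y∙xz _ _ _)) ⟩
          - (sign (toℕ k) * sign (toℕ j)) * (M zero k * (M (suc zero) (punchIn k j) * D k j))
            ≈⟨ sym (-‿distribˡ-* _ _) ⟩
          - ((sign (toℕ k) * sign (toℕ j)) * (M zero k * (M (suc zero) (punchIn k j) * D k j)))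
            ≈⟨ -‿cong (sym (a[b[c[de]]]≈[ac][b[de]] _ _ _ _ _)) ⟩
          - g k j ∎
    det-equalRows₀ (suc n) M (suc s) M₀≈M₂₊ₛ =
      trans (det-expand (suc n) M (suc zero)) (sumFin-zero (suc (suc n)) (λ j →
        x*[y*z]≈0 (M (suc zero) j) (sign 1)
          (trans (*-congˡ (det-equalRows (suc n) (minor M (suc zero) j) {zero} {suc s} (λ ()) (λ y → M₀≈M₂₊ₛ (punchIn j y))))
                 (zeroʳ (sign (toℕ j))))))

  det-linearRow : ∀ n m (R : Matrix (suc n)) r (a : Fin m → Carrier) (V : Fin m → Fin (suc n) → Carrier) →
    (∀ j → R r j ≈ sumFin m (λ k → a k * V k j)) →
    det (suc n) R ≈ sumFin m (λ k → a k * det (suc n) (replaceRow R r (V k)))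
  det-linearRow n m R r a V row = begin
    det (suc n) R
      ≈⟨ det-expand n R r ⟩
    sumFin (suc n) (λ j → R r j * cofactor R r j)
      ≈⟨ sumFin-cong (suc n) (λ j → trans (*-congʳ (row j)) (*-distribʳ-sumFin m (cofactor R r j) (λ k → a k * V k j))) ⟩
    sumFin (suc n) (λ j → sumFin m (λ k → (a k * V k j) * cofactor R r j))
      ≈⟨ sumFin-comm (suc n) m (λ j k → (a k * V k j) * cofactor R r j) ⟩
    sumFin m (λ k → sumFin (suc n) (λ j → (a k * V k j) * cofactor R r j))
      ≈⟨ sumFin-cong m (λ k → trans (sumFin-cong (suc n) (λ j → *-assoc (a k) (V k j) (cofactor R r j)))
                                    (sym (*-distribˡ-sumFin (suc n) (a k) (λ j → V k j * cofactor R r j)))) ⟩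
    sumFin m (λ k → a k * sumFin (suc n) (λ j → V k j * cofactor R r j))
      ≈⟨ sumFin-cong m (λ k → *-congˡ (sym (det-replaceRow n R r (V k)))) ⟩
    sumFin m (λ k → a k * det (suc n) (replaceRow R r (V k))) ∎

  det-permuteRows : ∀ n (σ : Fin n → Fin n) → ∃ λ κ → ∀ M → det n (M ∘ σ) ≈ κ * det n M
  det-permuteRows ℕ.zero  σ = 1# , λ M → sym (*-identityˡ 1#)
  det-permuteRows (suc n) σ with any? (λ r → σ (suc r) Fin.≟ σ zero)
  ... | yes (r , σ₁₊ᵣ≡σ₀) = 0# , λ M →
    trans (det-equalRows (suc n) (M ∘ σ) {zero} {suc r} (λ ())
                         (λ j → ≡⇒≈ (≡.cong (λ i → M i j) (≡.sym σ₁₊ᵣ≡σ₀))))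
          (sym (zeroˡ _))
  ... | no σ₀∉σ₁₊ = κ , λ M → begin
    det (suc n) (M ∘ σ)
      ≈⟨ sumFin-cong (suc n) (λ j → *-congˡ {sign (toℕ j)} (*-congˡ {M (σ zero) j} (minorFactor M j))) ⟩
    sumFin (suc n) (λ j → sign (toℕ j) * (M (σ zero) j * (proj₁ permuteMinor * det n (minor M (σ zero) j))))
      ≈⟨ sumFin-cong (suc n) (λ j → regroup (M (σ zero) j) (sign (toℕ j)) (det n (minor M (σ zero) j))) ⟩
    sumFin (suc n) (λ j → κ * (M (σ zero) j * cofactor M (σ zero) j))
      ≈⟨ sym (*-distribˡ-sumFin (suc n) κ (λ j → M (σ zero) j * cofactor M (σ zero) j)) ⟩
    κ * sumFin (suc n) (λ j → M (σ zero) j * cofactor M (σ zero) j)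
      ≈⟨ *-congˡ (sym (det-expand n M (σ zero))) ⟩
    κ * det (suc n) M ∎
    where
      τ : Fin n → Fin n
      τ r = punchOut (λ σ₀≡σ₁₊ᵣ → σ₀∉σ₁₊ (r , ≡.sym σ₀≡σ₁₊ᵣ))
      permuteMinor : ∃ λ κ → ∀ M → det n (M ∘ τ) ≈ κ * det n M
      permuteMinor = det-permuteRows n τ
      s₀ : Carrier
      s₀ = sign (toℕ (σ zero))
      κ : Carrier
      κ = s₀ * proj₁ permuteMinor
      minorFactor : ∀ M j → det n (λ r k → M (σ (suc r)) (punchIn j k)) ≈ proj₁ permuteMinor * det n (minor M (σ zero) j)
      minorFactor M j = trans (det-cong n (λ r k → ≡⇒≈ (≡.cong (λ i → M i (punchIn j k)) (≡.sym (punchIn-punchOut _)))))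
                              (proj₂ permuteMinor (minor M (σ zero) j))
      regroup : ∀ m s d → s * (m * (proj₁ permuteMinor * d)) ≈ κ * (m * (s₀ * (s * d)))
      regroup m s d = sym (trans ([ab][c[a[de]]]≈[aa][d[c[be]]] s₀ (proj₁ permuteMinor) m s d)
                                 (trans (*-congʳ (sign*sign (toℕ (σ zero)))) (*-identityˡ _)))

  _⊗_ : ∀ {n} → Matrix n → Matrix n → Matrix n
  (A ⊗ B) i j = sumFin _ (λ k → A i k * B k j)

  ⊗-identityʳ : ∀ {n} (A : Matrix n) i j → (A ⊗ δ) i j ≈ A i j
  ⊗-identityʳ {n} A i j =
    trans (sumFin-cong n (λ k → trans (*-comm (A i k) (δ k j)) (*-congʳ (δ-sym k j)))) (sumFin-δ n j (A i))

  det-identity : ∀ n → det n δ ≈ 1#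
  det-identity ℕ.zero  = refl
  det-identity (suc n) = begin
    det (suc n) δ
      ≈⟨ sumFin-single (suc n) (λ j → sign (toℕ j) * (δ zero j * det n (minor δ zero j))) zero (λ j j≢0 →
           trans (*-congˡ (trans (*-congʳ (δ-≢ (j≢0 ∘ ≡.sym))) (zeroˡ _))) (zeroʳ (sign (toℕ j)))) ⟩
    1# * (δ {suc n} zero zero * det n (minor δ zero zero))
      ≈⟨ trans (*-identityˡ _) (*-cong (δ-refl {suc n} zero) (det-cong n δ-suc)) ⟩
    1# * det n δ
      ≈⟨ trans (*-identityˡ _) (det-identity n) ⟩
    1# ∎

  MixedRows : ∀ {n} → Matrix n → ℕ → (Fin n → Fin n) → Matrix n → Matrix n → Set ℓ
  MixedRows A r σ M R = (∀ i → toℕ i ℕ.< r → ∀ j → R i j ≈ (A ⊗ M) i j)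
                      × (∀ i → r ≤ toℕ i → ∀ j → R i j ≈ M (σ i) j)

  -- Expanding the rows below r by linearity leaves only matrices with permuted rows of M,
  -- so the factor κ depends on A, r and σ but not on M.
  det-⊗-partial : ∀ n (A : Matrix n) r → r ≤ n → (σ : Fin n → Fin n) →
    ∃ λ κ → ∀ M R → MixedRows A r σ M R → det n R ≈ κ * det n M
  det-⊗-partial n A ℕ.zero _ σ = proj₁ (det-permuteRows n σ) , λ M R (_ , permuted) →
    trans (det-cong n (λ i → permuted i ℕ.z≤n)) (proj₂ (det-permuteRows n σ) M)
  det-⊗-partial (suc n) A (suc r) r<n σ = κ , λ M R (combined , permuted) → begin
    det (suc n) R
      ≈⟨ det-linearRow n (suc n) R i₀ (A i₀) M (combined i₀ i₀<1+r) ⟩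
    sumFin (suc n) (λ k → A i₀ k * det (suc n) (replaceRow R i₀ (M k)))
      ≈⟨ sumFin-cong (suc n) (λ k → *-congˡ {A i₀ k} (proj₂ (expanded k) M (replaceRow R i₀ (M k))
                                                  (combined′ M R combined k , permuted′ M R permuted k))) ⟩
    sumFin (suc n) (λ k → A i₀ k * (proj₁ (expanded k) * det (suc n) M))
      ≈⟨ sumFin-cong (suc n) (λ k → sym (*-assoc (A i₀ k) (proj₁ (expanded k)) (det (suc n) M))) ⟩
    sumFin (suc n) (λ k → (A i₀ k * proj₁ (expanded k)) * det (suc n) M)
      ≈⟨ sym (*-distribʳ-sumFin (suc n) _ (λ k → A i₀ k * proj₁ (expanded k))) ⟩
    κ * det (suc n) M ∎
    where
      i₀ : Fin (suc n)
      i₀ = Fin.fromℕ< r<n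
      i₀<1+r : toℕ i₀ ℕ.< suc r
      i₀<1+r = ℕP.≤-reflexive (≡.cong suc (toℕ-fromℕ< r<n))
      toℕ≡r⇒≡i₀ : ∀ {i} → toℕ i ≡ r → i ≡ i₀
      toℕ≡r⇒≡i₀ i≡r = toℕ-injective (≡.trans i≡r (≡.sym (toℕ-fromℕ< r<n)))
      expanded : ∀ k → ∃ λ κ → ∀ M R → MixedRows A r (updateAt σ i₀ (const k)) M R → det (suc n) R ≈ κ * det (suc n) M
      expanded k = det-⊗-partial (suc n) A r (ℕP.<⇒≤ r<n) (updateAt σ i₀ (const k))
      κ : Carrier
      κ = sumFin (suc n) (λ k → A i₀ k * proj₁ (expanded k))
      combined′ : ∀ M R → (∀ i → toℕ i ℕ.< suc r → ∀ j → R i j ≈ (A ⊗ M) i j) →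
                  ∀ k i → toℕ i ℕ.< r → ∀ j → replaceRow R i₀ (M k) i j ≈ (A ⊗ M) i j
      combined′ M R combined k i i<r j =
        trans (replaceRow-≢ R (M k) j (λ i≡i₀ → ℕP.<-irrefl (≡.trans (≡.cong toℕ i≡i₀) (toℕ-fromℕ< r<n)) i<r))
              (combined i (ℕP.m<n⇒m<1+n i<r) j)
      permuted′ : ∀ M R → (∀ i → suc r ≤ toℕ i → ∀ j → R i j ≈ M (σ i) j) →
                  ∀ k i → r ≤ toℕ i → ∀ j → replaceRow R i₀ (M k) i j ≈ M (updateAt σ i₀ (const k) i) j
      permuted′ M R permuted k i r≤i j with i Fin.≟ i₀
      ... | yes ≡.refl = trans (replaceRow-≡ R i₀ (M k) j) (≡⇒≈ (≡.cong (λ l → M l j) (≡.sym (updateAt-updates i₀ σ))))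
      ... | no i≢i₀ = trans (replaceRow-≢ R (M k) j i≢i₀)
        (trans (permuted i (ℕP.≤∧≢⇒< r≤i (λ r≡i → i≢i₀ (toℕ≡r⇒≡i₀ (≡.sym r≡i)))) j)
               (≡⇒≈ (≡.cong (λ l → M l j) (≡.sym (updateAt-minimal i i₀ σ i≢i₀)))))

  det-⊗ : ∀ n (A M : Matrix n) → det n (A ⊗ M) ≈ det n A * det n M
  det-⊗ n A M = trans (factor M) (*-congʳ κ≈detA)
    where
      partial : ∃ λ κ → ∀ M R → MixedRows A n id M R → det n R ≈ κ * det n M
      partial = det-⊗-partial n A n ℕP.≤-refl id
      κ : Carrier
      κ = proj₁ partial
      factor : ∀ M → det n (A ⊗ M) ≈ κ * det n M
      factor M = proj₂ partial M (A ⊗ M) ((λ _ _ _ → refl) , (λ i n≤i → ⊥-elim (ℕP.<⇒≱ (toℕ<n i) n≤i)))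
      κ≈detA : κ ≈ det n A
      κ≈detA = begin
        κ               ≈⟨ sym (trans (*-congˡ (det-identity n)) (*-identityʳ κ)) ⟩
        κ * det n δ     ≈⟨ sym (factor δ) ⟩
        det n (A ⊗ δ)   ≈⟨ det-cong n (⊗-identityʳ A) ⟩
        det n A         ∎

  cofactor-expansion : ∀ n (M : Matrix (suc n)) k r →
                       sumFin (suc n) (λ j → M k j * cofactor M r j) ≈ δ k r * det (suc n) M
  cofactor-expansion n M k r = by-cases (k Fin.≟ r)
    where
      by-cases : Dec (k ≡ r) → sumFin (suc n) (λ j → M k j * cofactor M r j) ≈ δ k r * det (suc n) M
      by-cases (yes k≡r) = begin
        sumFin (suc n) (λ j → M k j * cofactor M r j)
          ≈⟨ sumFin-cong (suc n) (λ j → ≡⇒≈ (≡.cong (λ l → M l j * cofactor M r j) k≡r)) ⟩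
        sumFin (suc n) (λ j → M r j * cofactor M r j)
          ≈⟨ sym (det-expand n M r) ⟩
        det (suc n) M
          ≈⟨ sym (trans (*-congʳ (δ-≡ k≡r)) (*-identityˡ _)) ⟩
        δ k r * det (suc n) M ∎
      by-cases (no k≢r) = begin
        sumFin (suc n) (λ j → M k j * cofactor M r j)  ≈⟨ sym (det-replaceRow n M r (M k)) ⟩
        det (suc n) (replaceRow M r (M k))              ≈⟨ det-equalRows (suc n) (replaceRow M r (M k)) k≢r equal ⟩
        0#                                              ≈⟨ sym (trans (*-congʳ (δ-≢ k≢r)) (zeroˡ _)) ⟩
        δ k r * det (suc n) M                           ∎
        where
          equal : ∀ j → replaceRow M r (M k) k j ≈ replaceRow M r (M k) r j
          equal j = trans (replaceRow-≢ M (M k) j k≢r) (sym (replaceRow-≡ M r (M k) j))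

  leftInverse⇒det≉0 : ∀ n (B M : Matrix n) → (∀ i j → (B ⊗ M) i j ≈ δ i j) → ¬ det n M ≈ 0#
  leftInverse⇒det≉0 n B M BM≈I detM≈0 = nontrivial (begin
    1#                   ≈⟨ sym (det-identity n) ⟩
    det n δ              ≈⟨ sym (det-cong n BM≈I) ⟩
    det n (B ⊗ M)        ≈⟨ det-⊗ n B M ⟩
    det n B * det n M    ≈⟨ trans (*-congˡ detM≈0) (zeroʳ _) ⟩
    0#                   ∎)

  leftInverse*det≈cofactor : ∀ n (B M : Matrix (suc n)) → (∀ i j → (B ⊗ M) i j ≈ δ i j) →
                            ∀ i r → B i r * det (suc n) M ≈ cofactor M r i
  leftInverse*det≈cofactor n B M BM≈I i r = begin
    B i r * det (suc n) M
      ≈⟨ sym (sumFin-δ (suc n) r (λ k → B i k * det (suc n) M)) ⟩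
    sumFin (suc n) (λ k → δ r k * (B i k * det (suc n) M))
      ≈⟨ sumFin-cong (suc n) (λ k → trans (*.x∙yz≈y∙xz (δ r k) (B i k) (det (suc n) M))
                                          (*-congˡ {B i k} (*-congʳ (δ-sym r k)))) ⟩
    sumFin (suc n) (λ k → B i k * (δ k r * det (suc n) M))
      ≈⟨ sumFin-cong (suc n) (λ k → *-congˡ {B i k} (sym (cofactor-expansion n M k r))) ⟩
    sumFin (suc n) (λ k → B i k * sumFin (suc n) (λ j → M k j * cofactor M r j))
      ≈⟨ sumFin-cong (suc n) (λ k → *-distribˡ-sumFin (suc n) (B i k) (λ j → M k j * cofactor M r j)) ⟩
    sumFin (suc n) (λ k → sumFin (suc n) (λ j → B i k * (M k j * cofactor M r j)))
      ≈⟨ sumFin-comm (suc n) (suc n) (λ k j → B i k * (M k j * cofactor M r j)) ⟩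
    sumFin (suc n) (λ j → sumFin (suc n) (λ k → B i k * (M k j * cofactor M r j)))
      ≈⟨ sumFin-cong (suc n) (λ j → trans (sumFin-cong (suc n) (λ k → sym (*-assoc (B i k) (M k j) (cofactor M r j))))
                                          (sym (*-distribʳ-sumFin (suc n) (cofactor M r j) (λ k → B i k * M k j)))) ⟩
    sumFin (suc n) (λ j → (B ⊗ M) i j * cofactor M r j)
      ≈⟨ sumFin-cong (suc n) (λ j → *-congʳ {cofactor M r j} (BM≈I i j)) ⟩
    sumFin (suc n) (λ j → δ i j * cofactor M r j)
      ≈⟨ sumFin-δ (suc n) i (cofactor M r) ⟩
    cofactor M r i ∎

  MooreMatrix : ∀ {n} → (Fin n → Carrier) → Matrix n
  MooreMatrix x i j = x j ^ (q ^ℕ toℕ i)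

  Moore-leftInverse-lastColumn : ∀ m (x : Fin (suc m) → Carrier) (B : Matrix (suc m)) →
    (∀ i j → (B ⊗ MooreMatrix x) i j ≈ δ i j) →
    Σ (¬ Moore (suc m) x ≈ 0#) λ Δ≉0 →
      ∀ i → B i (Fin.fromℕ m) ≈ sign (m +ℕ toℕ i) * (Moore m (x ∘ punchIn i) * inv (Moore (suc m) x) Δ≉0)
  Moore-leftInverse-lastColumn m x B BM≈I = Δ≉0 , λ i → trans (x*y≈z⇒x≈z*y⁻¹ Δ≉0 (entry i)) (*-assoc _ _ _)
    where
      L : Fin (suc m)
      L = Fin.fromℕ m
      Δ≉0 : ¬ Moore (suc m) x ≈ 0#
      Δ≉0 = leftInverse⇒det≉0 (suc m) B (MooreMatrix x) BM≈I
      entry : ∀ i → B i L * Moore (suc m) x ≈ sign (m +ℕ toℕ i) * Moore m (x ∘ punchIn i)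
      entry i = begin
        B i L * Moore (suc m) x
          ≈⟨ leftInverse*det≈cofactor m B (MooreMatrix x) BM≈I i L ⟩
        sign (toℕ L) * (sign (toℕ i) * det m (minor (MooreMatrix x) L i))
          ≈⟨ sym (*-assoc _ _ _) ⟩
        (sign (toℕ L) * sign (toℕ i)) * det m (minor (MooreMatrix x) L i)
          ≈⟨ *-cong (sym (sign-+ (toℕ L) (toℕ i)))
                    (det-cong m (λ k j → ≡⇒≈ (≡.cong (λ n → x (punchIn i j) ^ (q ^ℕ n)) (toℕ-punchIn-fromℕ k)))) ⟩
        sign (toℕ L +ℕ toℕ i) * Moore m (x ∘ punchIn i)
          ≡⟨ ≡.cong (λ n → sign (n +ℕ toℕ i) * Moore m (x ∘ punchIn i)) (toℕ-fromℕ m) ⟩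
        sign (m +ℕ toℕ i) * Moore m (x ∘ punchIn i) ∎

module Powers {c ℓ} (F : Field c ℓ) (q : ℕ) where
  open Field F hiding (zero)
  open Over F q
  open FieldFacts F
  open FiniteSums F q
  import Algebra.Properties.Semiring.Exp semiring as Exp
  import Algebra.Properties.CommutativeSemiring.Exp commutativeSemiring as CommExp
  open import Algebra.Properties.Semiring.Mult semiring using (×-assoc-*; ×-congʳ; ×1-homo-*) renaming (_×_ to _×ₙ_)
  open import Algebra.Properties.Monoid.Sum +-monoid using (sum)
  import Algebra.Properties.CommutativeSemiring.Binomial commutativeSemiring as Binomial
  open import Relation.Binary.Reasoning.Setoid setoid

  ^≡^ : ∀ x n → x ^ n ≡ x Exp.^ n
  ^≡^ x ℕ.zero  = ≡.refl
  ^≡^ x (suc n) = ≡.cong (x *_) (^≡^ x n)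

  sumFin≡sum : ∀ n (f : Fin n → Carrier) → sumFin n f ≡ sum f
  sumFin≡sum ℕ.zero  f = ≡.refl
  sumFin≡sum (suc n) f = ≡.cong (f zero +_) (sumFin≡sum n (λ i → f (suc i)))

  fromℕ≡×ₙ1# : ∀ n → fromℕ n ≡ n ×ₙ 1#
  fromℕ≡×ₙ1# ℕ.zero  = ≡.refl
  fromℕ≡×ₙ1# (suc n) = ≡.cong (1# +_) (fromℕ≡×ₙ1# n)

  ^-cong : ∀ n {x y} → x ≈ y → x ^ n ≈ y ^ n
  ^-cong n {x} {y} x≈y = trans (≡⇒≈ (^≡^ x n)) (trans (Exp.^-congˡ n x≈y) (≡⇒≈ (≡.sym (^≡^ y n))))

  ^-distrib-* : ∀ x y n → (x * y) ^ n ≈ x ^ n * y ^ n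
  ^-distrib-* x y n = trans (≡⇒≈ (^≡^ (x * y) n))
    (trans (CommExp.^-distrib-* x y n) (sym (*-cong (≡⇒≈ (^≡^ x n)) (≡⇒≈ (^≡^ y n)))))

  ^-assoc : ∀ x m n → (x ^ m) ^ n ≈ x ^ (m ℕ.* n)
  ^-assoc x m n = begin
    (x ^ m) ^ n          ≡⟨ ≡.trans (^≡^ (x ^ m) n) (≡.cong (Exp._^ n) (^≡^ x m)) ⟩
    (x Exp.^ m) Exp.^ n  ≈⟨ Exp.^-assocʳ x m n ⟩
    x Exp.^ (m ℕ.* n)    ≡⟨ ≡.sym (^≡^ x (m ℕ.* n)) ⟩
    x ^ (m ℕ.* n)        ∎

  1^n≈1 : ∀ n → 1# ^ n ≈ 1#
  1^n≈1 ℕ.zero  = refl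
  1^n≈1 (suc n) = trans (*-identityˡ _) (1^n≈1 n)

  0^n≈0 : ∀ n → 1 ≤ n → 0# ^ n ≈ 0#
  0^n≈0 (suc n) _ = zeroˡ _

  PowerAdditive : ℕ → Set (c ⊔ ℓ)
  PowerAdditive N = ∀ x y → (x + y) ^ N ≈ x ^ N + y ^ N

  powerAdditive-char : ∀ {p} → Prime p → fromℕ p ≈ 0# → PowerAdditive p
  powerAdditive-char {p@(suc p-1)} pr p≈0 x y = begin
    (x + y) ^ p
      ≡⟨ ^≡^ (x + y) p ⟩
    (x + y) Exp.^ p
      ≈⟨ Binomial.theorem p x y ⟩
    sum {suc p} (λ k → term (toℕ k))
      ≡⟨ ≡.sym (sumFin≡sum (suc p) (λ k → term (toℕ k))) ⟩
    term 0 + sumFin p (λ k → term (suc (toℕ k)))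
      ≈⟨ +-congˡ (sumFin-init-last p-1 (λ k → term (suc (toℕ k)))) ⟩
    term 0 + (sumFin p-1 (λ k → term (suc (toℕ (Fin.inject₁ k)))) + term (suc (toℕ (Fin.fromℕ p-1))))
      ≈⟨ +-cong term₀ (+-cong (sumFin-zero p-1 (λ k → middle (suc (toℕ (Fin.inject₁ k))) (ℕ.s≤s ℕ.z≤n)
                                                        (ℕ.s≤s (inject₁ℕ< k))))
                              (trans (≡⇒≈ (≡.cong (term ∘ suc) (toℕ-fromℕ p-1))) termₚ)) ⟩
    y ^ p + (0# + x ^ p)
      ≈⟨ trans (+-congˡ (+-identityˡ _)) (+-comm _ _) ⟩
    x ^ p + y ^ p ∎
    where
      monomial : ℕ → Carrier
      monomial k = x Exp.^ k * y Exp.^ (p ℕ.∸ k)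
      term : ℕ → Carrier
      term k = (p C k) ×ₙ monomial k
      term₀ : term 0 ≈ y ^ p
      term₀ = begin
        term 0       ≡⟨ ≡.cong (λ n → n ×ₙ (1# * y Exp.^ p)) (≡.trans (nCk≡nC[n∸k] {n = p} ℕ.z≤n) (nCn≡1 p)) ⟩
        1 ×ₙ (1# * y Exp.^ p) ≈⟨ trans (+-identityʳ _) (*-identityˡ _) ⟩
        y Exp.^ p    ≡⟨ ≡.sym (^≡^ y p) ⟩
        y ^ p        ∎
      termₚ : term p ≈ x ^ p
      termₚ = begin
        term p       ≡⟨ ≡.cong₂ (λ n m → n ×ₙ (x Exp.^ p * y Exp.^ m)) (nCn≡1 p) (ℕP.n∸n≡0 p) ⟩
        1 ×ₙ (x Exp.^ p * 1#) ≈⟨ trans (+-identityʳ _) (*-identityʳ _) ⟩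
        x Exp.^ p    ≡⟨ ≡.sym (^≡^ x p) ⟩
        x ^ p        ∎
      middle : ∀ k → 0 ℕ.< k → k ℕ.< p → term k ≈ 0#
      middle k 0<k k<p with prime∣C pr 0<k k<p
      ... | divides m pCk≡m*p = begin
        term k                             ≈⟨ sym (trans (×-assoc-* (p C k) 1# (monomial k)) (×-congʳ (p C k) (*-identityˡ _))) ⟩
        ((p C k) ×ₙ 1#) * monomial k        ≡⟨ ≡.cong (λ n → (n ×ₙ 1#) * monomial k) pCk≡m*p ⟩
        ((m ℕ.* p) ×ₙ 1#) * monomial k      ≈⟨ *-congʳ (×1-homo-* m p) ⟩
        ((m ×ₙ 1#) * (p ×ₙ 1#)) * monomial k ≈⟨ *-congʳ (*-congˡ (trans (≡⇒≈ (≡.sym (fromℕ≡×ₙ1# p))) p≈0)) ⟩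
        ((m ×ₙ 1#) * 0#) * monomial k       ≈⟨ trans (*-congʳ (zeroʳ _)) (zeroˡ _) ⟩
        0#                                 ∎

  powerAdditive-^ : ∀ {N} → PowerAdditive N → ∀ k → PowerAdditive (N ^ℕ k)
  powerAdditive-^ {N} additive ℕ.zero  x y = trans (*-identityʳ _) (sym (+-cong (*-identityʳ x) (*-identityʳ y)))
  powerAdditive-^ {N} additive (suc k) x y = begin
    (x + y) ^ (N ℕ.* N ^ℕ k)             ≈⟨ sym (^-assoc _ N (N ^ℕ k)) ⟩
    ((x + y) ^ N) ^ (N ^ℕ k)             ≈⟨ ^-cong (N ^ℕ k) (additive x y) ⟩
    (x ^ N + y ^ N) ^ (N ^ℕ k)           ≈⟨ powerAdditive-^ additive k (x ^ N) (y ^ N) ⟩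
    (x ^ N) ^ (N ^ℕ k) + (y ^ N) ^ (N ^ℕ k) ≈⟨ +-cong (^-assoc x N (N ^ℕ k)) (^-assoc y N (N ^ℕ k)) ⟩
    x ^ (N ℕ.* N ^ℕ k) + y ^ (N ℕ.* N ^ℕ k) ∎

  powerAdditive-neg : ∀ {N} → 1 ≤ N → PowerAdditive N → ∀ x → (- x) ^ N ≈ - (x ^ N)
  powerAdditive-neg {N} 1≤N additive x = +-inverseʳ-unique (x ^ N) ((- x) ^ N) (begin
    x ^ N + (- x) ^ N   ≈⟨ sym (additive x (- x)) ⟩
    (x + - x) ^ N       ≈⟨ ^-cong N (-‿inverseʳ x) ⟩
    0# ^ N              ≈⟨ 0^n≈0 N 1≤N ⟩
    0#                  ∎)

  powerAdditive-sign : ∀ {N} → 1 ≤ N → PowerAdditive N → ∀ n → sign n ^ N ≈ sign n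
  powerAdditive-sign {N} 1≤N additive ℕ.zero  = 1^n≈1 N
  powerAdditive-sign {N} 1≤N additive (suc n) =
    trans (powerAdditive-neg 1≤N additive (sign n)) (-‿cong (powerAdditive-sign 1≤N additive n))

  powerAdditive-sign* : ∀ {N} → 1 ≤ N → PowerAdditive N → ∀ n x → (sign n * x) ^ N ≈ sign n * x ^ N
  powerAdditive-sign* {N} 1≤N additive n x =
    trans (^-distrib-* (sign n) x N) (*-congʳ (powerAdditive-sign 1≤N additive n))

module TwistedPolynomials {c ℓ} (F : Field c ℓ) (q : ℕ) (1≤q : 1 ≤ q) where
  open Field F hiding (zero)
  open Over F q
  open FieldFacts F
  open FiniteSums F q
  open Powers F q
  open import Relation.Binary.Reasoning.Setoid setoid

  coeff-+τ : ∀ f g n → coeff (f +τ g) n ≈ coeff f n + coeff g n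
  coeff-+τ []      g       n       = sym (+-identityˡ _)
  coeff-+τ (a ∷ f) []      n       = sym (+-identityʳ _)
  coeff-+τ (a ∷ f) (b ∷ g) ℕ.zero  = refl
  coeff-+τ (a ∷ f) (b ∷ g) (suc n) = coeff-+τ f g n

  coeff-scale : ∀ a f n → coeff (scale a f) n ≈ a * coeff f n
  coeff-scale a []      n       = sym (zeroʳ a)
  coeff-scale a (b ∷ f) ℕ.zero  = refl
  coeff-scale a (b ∷ f) (suc n) = coeff-scale a f n

  coeff-map-^q : ∀ g n → coeff (map (_^ q) g) n ≈ coeff g n ^ q
  coeff-map-^q []      n       = sym (0^n≈0 q 1≤q)
  coeff-map-^q (a ∷ g) ℕ.zero  = refl
  coeff-map-^q (a ∷ g) (suc n) = coeff-map-^q g n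

  coeff-scalar*τ : ∀ a g n → coeff ((a ∷ []) *τ g) n ≈ a * coeff g n
  coeff-scalar*τ a g n = trans (coeff-+τ (scale a g) [] n) (trans (+-identityʳ _) (coeff-scale a g n))

  coeff-[1-τ]*τ : ∀ h n → coeff ((1# ∷ - 1# ∷ []) *τ h) n ≈ coeff h n + - coeff (τ· h) n
  coeff-[1-τ]*τ h n = trans (coeff-+τ (scale 1# h) ((- 1# ∷ []) *τ (τ· h)) n)
    (+-cong (trans (coeff-scale 1# h n) (*-identityˡ _))
            (trans (coeff-scalar*τ (- 1#) (τ· h) n) (trans (sym (-‿distribˡ-* _ _)) (-‿cong (*-identityˡ _)))))

  hCoeff : Carrier → (ℕ → Carrier) → ℕ → Carrier
  hCoeff a cf ℕ.zero  = a * cf 0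
  hCoeff a cf (suc k) = hCoeff a cf k ^ q + a * cf (suc k)

  coeff-quotient : ∀ a Cn h → ((a ∷ []) *τ Cn) ≈τ ((1# ∷ - 1# ∷ []) *τ h) →
                   ∀ k → coeff h k ≈ hCoeff a (coeff Cn) k
  coeff-quotient a Cn h aC≈[1-τ]h ℕ.zero = begin
    coeff h 0                        ≈⟨ sym (+-identityʳ _) ⟩
    coeff h 0 + 0#                   ≈⟨ +-congˡ (sym -0#≈0#) ⟩
    coeff h 0 + - coeff (τ· h) 0     ≈⟨ sym (coeff-[1-τ]*τ h 0) ⟩
    coeff ((1# ∷ - 1# ∷ []) *τ h) 0  ≈⟨ sym (aC≈[1-τ]h 0) ⟩
    coeff ((a ∷ []) *τ Cn) 0         ≈⟨ coeff-scalar*τ a Cn 0 ⟩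
    a * coeff Cn 0                   ∎
  coeff-quotient a Cn h aC≈[1-τ]h (suc k) = begin
    coeff h (suc k)                                        ≈⟨ sym (+-identityʳ _) ⟩
    coeff h (suc k) + 0#                                   ≈⟨ +-congˡ (sym (-‿inverseˡ _)) ⟩
    coeff h (suc k) + (- coeff (τ· h) (suc k) + coeff (τ· h) (suc k)) ≈⟨ sym (+-assoc _ _ _) ⟩
    (coeff h (suc k) + - coeff (τ· h) (suc k)) + coeff (τ· h) (suc k) ≈⟨ +-comm _ _ ⟩
    coeff (τ· h) (suc k) + (coeff h (suc k) + - coeff (τ· h) (suc k))
      ≈⟨ +-cong (trans (coeff-map-^q h k) (^-cong q (coeff-quotient a Cn h aC≈[1-τ]h k)))
                (trans (sym (coeff-[1-τ]*τ h (suc k))) (trans (sym (aC≈[1-τ]h (suc k))) (coeff-scalar*τ a Cn (suc k)))) ⟩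
    hCoeff a (coeff Cn) k ^ q + a * coeff Cn (suc k)      ∎

  apply-zero : ∀ h x → (∀ k → coeff h k ≈ 0#) → apply h x ≈ 0#
  apply-zero []      x h≈0 = refl
  apply-zero (a ∷ f) x h≈0 =
    trans (+-cong (trans (*-congʳ (h≈0 0)) (zeroˡ x)) (apply-zero f (x ^ q) (h≈0 ∘ suc))) (+-identityˡ 0#)

  apply-sumFin : ∀ d h x → (∀ k → d ≤ k → coeff h k ≈ 0#) →
                 apply h x ≈ sumFin d (λ k → coeff h (toℕ k) * x ^ (q ^ℕ toℕ k))
  apply-sumFin ℕ.zero  h       x h≈0 = apply-zero h x (λ k → h≈0 k ℕ.z≤n)
  apply-sumFin (suc d) []      x h≈0 = sym (sumFin-zero (suc d) (λ k → zeroˡ (x ^ (q ^ℕ toℕ k))))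
  apply-sumFin (suc d) (a ∷ f) x h≈0 =
    +-cong (*-congˡ (sym (*-identityʳ x)))
      (trans (apply-sumFin d f (x ^ q) (λ k d≤k → h≈0 (suc k) (ℕ.s≤s d≤k)))
             (sumFin-cong d (λ i → *-congˡ (^-assoc x q (q ^ℕ toℕ i)))))

  -- hₖ = Σᵢ₌₀ᵏ (a cᵢ)^(q^(k-i)), so q^i-th roots rᵢ of a cᵢ turn it into (Σᵢ rᵢ)^(q^k).
  hCoeff-roots : (∀ k → PowerAdditive (q ^ℕ k)) → ∀ D (r : Fin (suc D) → Carrier) cf a →
                 (∀ i → r i ^ (q ^ℕ toℕ i) ≈ cf (toℕ i) * a) → hCoeff a cf D ≈ sumFin (suc D) r ^ (q ^ℕ D)
  hCoeff-roots additive ℕ.zero r cf a roots = begin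
    a * cf 0            ≈⟨ *-comm a (cf 0) ⟩
    cf 0 * a            ≈⟨ sym (roots zero) ⟩
    r zero ^ 1          ≈⟨ ^-cong 1 (sym (+-identityʳ (r zero))) ⟩
    (r zero + 0#) ^ 1   ∎
  hCoeff-roots additive (suc D) r cf a roots = begin
    hCoeff a cf D ^ q + a * cf (suc D)
      ≈⟨ +-cong (^-cong q (hCoeff-roots additive D (r ∘ Fin.inject₁) cf a roots′)) (trans (*-comm a _) (sym rootₗ)) ⟩
    (S ^ (q ^ℕ D)) ^ q + r (Fin.fromℕ (suc D)) ^ (q ^ℕ suc D)
      ≈⟨ +-congʳ (trans (^-assoc S (q ^ℕ D) q) (≡⇒≈ (≡.cong (S ^_) (ℕP.*-comm (q ^ℕ D) q)))) ⟩
    S ^ (q ^ℕ suc D) + r (Fin.fromℕ (suc D)) ^ (q ^ℕ suc D)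
      ≈⟨ sym (additive (suc D) S (r (Fin.fromℕ (suc D)))) ⟩
    (S + r (Fin.fromℕ (suc D))) ^ (q ^ℕ suc D)
      ≈⟨ ^-cong (q ^ℕ suc D) (sym (sumFin-init-last (suc D) r)) ⟩
    sumFin (suc (suc D)) r ^ (q ^ℕ suc D) ∎
    where
      S : Carrier
      S = sumFin (suc D) (r ∘ Fin.inject₁)
      roots′ : ∀ i → r (Fin.inject₁ i) ^ (q ^ℕ toℕ i) ≈ cf (toℕ i) * a
      roots′ i = ≡.subst (λ n → r (Fin.inject₁ i) ^ (q ^ℕ n) ≈ cf n * a) (toℕ-inject₁ i) (roots (Fin.inject₁ i))
      rootₗ : r (Fin.fromℕ (suc D)) ^ (q ^ℕ suc D) ≈ cf (suc D) * a
      rootₗ = ≡.subst (λ n → r (Fin.fromℕ (suc D)) ^ (q ^ℕ n) ≈ cf n * a) (toℕ-fromℕ (suc D)) (roots (Fin.fromℕ (suc D)))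

  module CarlitzCoefficients (t : Carrier) where
    open Carlitz t
    open import Data.List.Properties using (length-map)

    coeff-C∷ : ∀ a as n → coeff (C (a ∷ as)) n ≈ coeff (a ∷ []) n + (t * coeff (C as) n + coeff (τ· C as) n)
    coeff-C∷ a as n = trans (coeff-+τ (a ∷ []) (Cθ *τ C as) n)
      (+-congˡ (trans (coeff-+τ (scale t (C as)) ((1# ∷ []) *τ (τ· C as)) n)
                      (+-cong (coeff-scale t (C as) n) (trans (coeff-scalar*τ 1# (τ· C as) n) (*-identityˡ _)))))

    length-+τ : ∀ f g → length (f +τ g) ≡ length f ℕ.⊔ length g
    length-+τ []      g       = ≡.refl
    length-+τ (a ∷ f) []      = ≡.refl
    length-+τ (a ∷ f) (b ∷ g) = ≡.cong suc (length-+τ f g)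

    length-Cθ*τ : ∀ g → length (Cθ *τ g) ≡ suc (length g)
    length-Cθ*τ g = ≡.trans (length-+τ (scale t g) (scale 1# (τ· g)))
      (≡.trans (≡.cong₂ ℕ._⊔_ (length-map (t *_) g) (≡.trans (length-map (1# *_) (τ· g)) (≡.cong suc (length-map (_^ q) g))))
               (ℕP.m≤n⇒m⊔n≡n (ℕP.n≤1+n (length g))))

    length-C : ∀ bs → length (C (bs ++ 1# ∷ [])) ≡ suc (length bs)
    length-C []       = ≡.refl
    length-C (b ∷ bs) = ≡.trans (length-+τ (b ∷ []) (Cθ *τ C (bs ++ 1# ∷ [])))
                                (≡.cong (1 ℕ.⊔_) (≡.trans (length-Cθ*τ (C (bs ++ 1# ∷ []))) (≡.cong suc (length-C bs))))

    coeff-C-above : ∀ bs n → length bs ℕ.< n → coeff (C (bs ++ 1# ∷ [])) n ≈ 0#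
    coeff-C-above []       (suc n) _ = begin
      coeff (C (1# ∷ [])) (suc n)                 ≈⟨ coeff-C∷ 1# [] (suc n) ⟩
      0# + (t * 0# + 0#)                          ≈⟨ trans (+-identityˡ _) (trans (+-identityʳ _) (zeroʳ t)) ⟩
      0#                                          ∎
    coeff-C-above (b ∷ bs) (suc n) (ℕ.s≤s bs<n) = begin
      coeff (C (b ∷ bs ++ 1# ∷ [])) (suc n)
        ≈⟨ coeff-C∷ b (bs ++ 1# ∷ []) (suc n) ⟩
      0# + (t * coeff (C (bs ++ 1# ∷ [])) (suc n) + coeff (map (_^ q) (C (bs ++ 1# ∷ []))) n)
        ≈⟨ +-congˡ (+-cong (*-congˡ (coeff-C-above bs (suc n) (ℕP.m<n⇒m<1+n bs<n)))
                           (trans (coeff-map-^q (C (bs ++ 1# ∷ [])) n) (trans (^-cong q (coeff-C-above bs n bs<n)) (0^n≈0 q 1≤q)))) ⟩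
      0# + (t * 0# + 0#)
        ≈⟨ trans (+-identityˡ _) (trans (+-identityʳ _) (zeroʳ t)) ⟩
      0# ∎

    coeff-C-leading : ∀ bs → coeff (C (bs ++ 1# ∷ [])) (length bs) ≈ 1#
    coeff-C-leading []       = begin
      coeff (C (1# ∷ [])) 0                       ≈⟨ coeff-C∷ 1# [] 0 ⟩
      1# + (t * 0# + 0#)                          ≈⟨ trans (+-congˡ (trans (+-identityʳ _) (zeroʳ t))) (+-identityʳ 1#) ⟩
      1#                                          ∎
    coeff-C-leading (b ∷ bs) = begin
      coeff (C (b ∷ bs ++ 1# ∷ [])) (suc (length bs))
        ≈⟨ coeff-C∷ b (bs ++ 1# ∷ []) (suc (length bs)) ⟩
      0# + (t * coeff (C (bs ++ 1# ∷ [])) (suc (length bs)) + coeff (map (_^ q) (C (bs ++ 1# ∷ []))) (length bs))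
        ≈⟨ +-congˡ (+-cong (*-congˡ (coeff-C-above bs (suc (length bs)) ℕP.≤-refl))
                           (trans (coeff-map-^q (C (bs ++ 1# ∷ [])) (length bs)) (trans (^-cong q (coeff-C-leading bs)) (1^n≈1 q)))) ⟩
      0# + (t * 0# + 1#)
        ≈⟨ trans (+-identityˡ _) (trans (+-congʳ (zeroʳ t)) (+-identityˡ 1#)) ⟩
      1# ∎

module PoonenDuality {c ℓ} (F : Field c ℓ) (q : ℕ) (1≤q : 1 ≤ q) (t : Field.Carrier F)
                     (additive : Powers.PowerAdditive F q q)
                     (m : ℕ) (n₀ : Fin (suc m) → Field.Carrier F) where
  open Field F hiding (zero)
  open Over F q
  open Carlitz t
  open FieldFacts F
  open FiniteSums F q
  open Determinants F q
  open Powers F q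
  open TwistedPolynomials F q 1≤q
  open CarlitzCoefficients t
  open import Data.List.Properties using (length-tabulate)
  open import Relation.Binary.Reasoning.Setoid setoid

  𝔫 : List Carrier
  𝔫 = tabulate n₀ ++ 1# ∷ []

  cf : ℕ → Carrier
  cf = coeff (C 𝔫)

  cf-leading : cf (suc m) ≈ 1#
  cf-leading = ≡.subst (λ n → cf n ≈ 1#) (length-tabulate n₀) (coeff-C-leading (tabulate n₀))

  cf-above : ∀ k → suc m ℕ.< k → cf k ≈ 0#
  cf-above k m<k = coeff-C-above (tabulate n₀) k (≡.subst (ℕ._< k) (≡.sym (length-tabulate n₀)) m<k)

  hCoeff-degree : ∀ {a} → InΛ* 𝔫 a → hCoeff a cf (suc m) ≈ 0#
  hCoeff-degree {a} (r , roots , Σr≈0) =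
    vanish (length (C 𝔫)) (≡.trans (length-C (tabulate n₀)) (≡.cong suc (length-tabulate n₀))) r roots Σr≈0
    where
      vanish : ∀ L → L ≡ suc (suc m) → (r : Fin L → Carrier) → (∀ i → r i ^ (q ^ℕ toℕ i) ≈ cf (toℕ i) * a) →
               sumFin L r ≈ 0# → hCoeff a cf (suc m) ≈ 0#
      vanish _ ≡.refl r roots Σr≈0 = begin
        hCoeff a cf (suc m)              ≈⟨ hCoeff-roots (powerAdditive-^ additive) (suc m) r cf a roots ⟩
        sumFin (suc (suc m)) r ^ (q ^ℕ suc m) ≈⟨ ^-cong (q ^ℕ suc m) Σr≈0 ⟩
        0# ^ (q ^ℕ suc m)                ≈⟨ 0^n≈0 (q ^ℕ suc m) (ℕP.m^n>0 q {{ℕ.>-nonZero 1≤q}} (suc m)) ⟩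
        0#                               ∎

  hCoeff-above : ∀ {a} → InΛ* 𝔫 a → ∀ k → suc m ≤ k → hCoeff a cf k ≈ 0#
  hCoeff-above {a} a∈Λ* k m<k = ≡.subst (λ n → hCoeff a cf n ≈ 0#) (ℕP.m+[n∸m]≡n m<k) (from (k ℕ.∸ suc m))
    where
      from : ∀ d → hCoeff a cf (suc m +ℕ d) ≈ 0#
      from ℕ.zero  = ≡.subst (λ n → hCoeff a cf n ≈ 0#) (≡.sym (ℕP.+-identityʳ (suc m))) (hCoeff-degree a∈Λ*)
      from (suc d) = ≡.subst (λ n → hCoeff a cf n ≈ 0#) (≡.sym (ℕP.+-suc (suc m) d))
        (trans (+-cong (trans (^-cong q (from d)) (0^n≈0 q 1≤q))
                       (trans (*-congˡ (cf-above (suc (suc m +ℕ d)) (ℕ.s≤s (ℕ.s≤s (ℕP.m≤m+n m d))))) (zeroʳ a)))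
               (+-identityˡ 0#))

  Λ*-element : ∀ {a} → InΛ* 𝔫 a → a ≈ (- hCoeff a cf m) ^ q
  Λ*-element {a} a∈Λ* = trans
    (+-inverseʳ-unique (hCoeff a cf m ^ q) a
      (trans (+-congˡ (sym (trans (*-congˡ cf-leading) (*-identityʳ a)))) (hCoeff-degree a∈Λ*)))
    (sym (powerAdditive-neg 1≤q additive (hCoeff a cf m)))

  PoonenPairing-sum : ∀ {a b v} → InΛ* 𝔫 a → PoonenPairing 𝔫 a b v →
                      sumFin (suc m) (λ k → hCoeff a cf (toℕ k) * b ^ (q ^ℕ toℕ k)) ≈ v
  PoonenPairing-sum {a} {b} {v} a∈Λ* (h , aC≈[1-τ]h , h[b]≈v) = begin
    sumFin (suc m) (λ k → hCoeff a cf (toℕ k) * b ^ (q ^ℕ toℕ k))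
      ≈⟨ sumFin-cong (suc m) (λ k → *-congʳ {b ^ (q ^ℕ toℕ k)} (sym (h≈hCoeff (toℕ k)))) ⟩
    sumFin (suc m) (λ k → coeff h (toℕ k) * b ^ (q ^ℕ toℕ k))
      ≈⟨ sym (apply-sumFin (suc m) h b (λ k m<k → trans (h≈hCoeff k) (hCoeff-above a∈Λ* k m<k))) ⟩
    apply h b
      ≈⟨ h[b]≈v ⟩
    v ∎
    where
      h≈hCoeff : ∀ k → coeff h k ≈ hCoeff a cf k
      h≈hCoeff = coeff-quotient a (C 𝔫) h aC≈[1-τ]h

  dualMatrix : (Fin (suc m) → Carrier) → Matrix (suc m)
  dualMatrix λ* i k = - hCoeff (λ* i) cf (toℕ k)

  dualMatrix-leftInverse : ∀ (λs λ* : Fin (suc m) → Carrier) → (∀ i → InΛ* 𝔫 (λ* i)) →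
    (∀ i j → PoonenPairing 𝔫 (λ* i) (λs j) (- δ i j)) →
    ∀ i j → (dualMatrix λ* ⊗ MooreMatrix λs) i j ≈ δ i j
  dualMatrix-leftInverse λs λ* λ*∈Λ* pairing i j = begin
    sumFin (suc m) (λ k → - hCoeff (λ* i) cf (toℕ k) * λs j ^ (q ^ℕ toℕ k))
      ≈⟨ sumFin-cong (suc m) (λ k → sym (-‿distribˡ-* (hCoeff (λ* i) cf (toℕ k)) (λs j ^ (q ^ℕ toℕ k)))) ⟩
    sumFin (suc m) (λ k → - (hCoeff (λ* i) cf (toℕ k) * λs j ^ (q ^ℕ toℕ k)))
      ≈⟨ sym (-‿sumFin (suc m) (λ k → hCoeff (λ* i) cf (toℕ k) * λs j ^ (q ^ℕ toℕ k))) ⟩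
    - sumFin (suc m) (λ k → hCoeff (λ* i) cf (toℕ k) * λs j ^ (q ^ℕ toℕ k))
      ≈⟨ -‿cong (PoonenPairing-sum (λ*∈Λ* i) (pairing i j)) ⟩
    - - δ i j
      ≈⟨ -‿involutive (δ i j) ⟩
    δ i j ∎

proposition6p8 : ∀ {c ℓ} (F : Field c ℓ) (p e : ℕ) → Prime p → 1 ≤ e →
    (t : Field.Carrier F) → IsAlgClosureOfFqθ F p (p ^ℕ e) t →
    let open Field F
        open Over F (p ^ℕ e)
        open Carlitz t
    in
    (m : ℕ) (n₀ : Fin (suc m) → Carrier) → (∀ k → InFq (n₀ k)) →
    let 𝔫 = tabulate n₀ ++ (1# ∷ [])
    in
    (lam : Fin (suc m) → Carrier) →
    (∀ j → InΛ 𝔫 (lam j)) →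
    (∀ (a : Fin (suc m) → Carrier) → (∀ j → InFq (a j)) →
       sumFin (suc m) (λ j → a j * lam j) ≈ 0# → ∀ j → a j ≈ 0#) →
    (∀ x → InΛ 𝔫 x → ∃ λ (a : Fin (suc m) → Carrier) →
       (∀ j → InFq (a j)) × (x ≈ sumFin (suc m) (λ j → a j * lam j))) →
    (lam* : Fin (suc m) → Carrier) →
    (∀ i → InΛ* 𝔫 (lam* i)) →
    (∀ i j → PoonenPairing 𝔫 (lam* i) (lam j) (- δ i j)) →
    Σ (¬ (Moore (suc m) lam ≈ 0#)) λ nz →
      ∀ i → lam* i ≈ sign (suc m +ℕ suc (toℕ i))
                       * ((Moore m (λ k → lam (punchIn i k)) * inv (Moore (suc m) lam) nz) ^ (p ^ℕ e))
proposition6p8 F p e p-prime _ t closure m n₀ _ lam _ _ _ lam* lam*∈Λ* pairing = Δ≉0 , formula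
  where
    open Field F hiding (zero)
    q : ℕ
    q = p ^ℕ e
    open Over F q
    open Powers F q
    open Determinants F q
    open SignsAndDeltas F q using (sign-suc+suc)
    open import Relation.Binary.Reasoning.Setoid setoid

    1≤q : 1 ≤ q
    1≤q = ℕP.m^n>0 p {{prime⇒nonZero p-prime}} e
    additive : PowerAdditive q
    additive = powerAdditive-^ (powerAdditive-char p-prime (IsAlgClosureOfFqθ.char-p closure)) e
    open TwistedPolynomials F q 1≤q using (hCoeff)
    open PoonenDuality F q 1≤q t additive m n₀

    inverse : Σ (¬ Moore (suc m) lam ≈ 0#) λ Δ≉0 → ∀ i → dualMatrix lam* i (Fin.fromℕ m)
                ≈ sign (m +ℕ toℕ i) * (Moore m (lam ∘ punchIn i) * inv (Moore (suc m) lam) Δ≉0)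
    inverse = Moore-leftInverse-lastColumn m lam (dualMatrix lam*) (dualMatrix-leftInverse lam lam* lam*∈Λ* pairing)
    Δ≉0 : ¬ Moore (suc m) lam ≈ 0#
    Δ≉0 = proj₁ inverse

    formula : ∀ i → lam* i ≈ sign (suc m +ℕ suc (toℕ i)) * ((Moore m (lam ∘ punchIn i) * inv (Moore (suc m) lam) Δ≉0) ^ q)
    formula i = begin
      lam* i                                ≈⟨ Λ*-element (lam*∈Λ* i) ⟩
      (- hCoeff (lam* i) cf m) ^ q          ≡⟨ ≡.cong (λ n → (- hCoeff (lam* i) cf n) ^ q) (≡.sym (toℕ-fromℕ m)) ⟩
      dualMatrix lam* i (Fin.fromℕ m) ^ q   ≈⟨ ^-cong q (proj₂ inverse i) ⟩
      (sign (m +ℕ toℕ i) * X) ^ q           ≈⟨ powerAdditive-sign* 1≤q additive (m +ℕ toℕ i) X ⟩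
      sign (m +ℕ toℕ i) * X ^ q             ≈⟨ *-congʳ (sym (sign-suc+suc m (toℕ i))) ⟩
      sign (suc m +ℕ suc (toℕ i)) * X ^ q   ∎
      where
        X : Carrier
        X = Moore m (lam ∘ punchIn i) * inv (Moore (suc m) lam) Δ≉0
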